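{- Let $G$ be a multigraph with incidence preference $A$, let $S\subseteq V(G)$ and $g:S\to\mathbb{N}$. Then $G$ has an orientation $D$ such that $d^-(v,A)\ge g(v)$ for all $v\in S$ if and only if for every induced subgraph $H$ of $G[S]$, $$\sum_{v\in V(H)} d(v,A)-|A(H)|\ge\sum_{v\in V(H)} g(v).$$
   Context: For a multigraph $G=(V,E)$, an incidence preference is a function $A:V\to\mathcal{P}(E)$. For $v\in V$, $E(v)$ is the set of edges incident to $v$ and $d(v,A)=d_G(v,A):=|E(v)\cap A(v)|$. An edge $uv$ is $A$-good if $uv\in A(u)\cap A(v)$; for a subgraph $H$, $A(H)$ is the set of $A$-good edges of $H$. For an orientation $D$ of $G$, $d^-(v,A)$ is the number of edges of $D$ directed from some $u$ to $v$ whose underlying edge $uv$ lies in $A(v)$. -}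

module Defs where

open import Data.Nat using (ℕ; zero; suc; _+_)
open import Data.Bool using (Bool; true; false; if_then_else_; _∧_; _∨_)
open import Data.Fin using (Fin; zero; suc; _≟_)
open import Data.Fin.Subset using (Subset)
open import Data.Vec using (lookup)
open import Data.Product using (_×_; proj₁; proj₂)
open import Relation.Nullary using (¬_)
open import Relation.Nullary.Decidable using (⌊_⌋)
open import Relation.Binary.PropositionalEquality using (_≡_)

∑ : ∀ {k} → (Fin k → ℕ) → ℕ
∑ {zero}  f = 0
∑ {suc k} f = f zero + ∑ (λ i → f (suc i))

count : ∀ {k} → (Fin k → Bool) → ℕ
count p = ∑ (λ i → if p i then 1 else 0)

record Multigraph : Set where
  field
    n        : ℕ
    m        : ℕ
    ends     : Fin m → Fin n × Fin n
    loopless : ∀ e → ¬ (proj₁ (ends e) ≡ proj₂ (ends e))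
open Multigraph public

_==_ : ∀ {k} → Fin k → Fin k → Bool
x == y = ⌊ x ≟ y ⌋

IncPref : Multigraph → Set
IncPref G = Fin (n G) → Subset (m G)

-- Orientation: for each edge, true = directed from proj₁ to proj₂ of ends,
-- false = directed from proj₂ to proj₁.
Orientation : Multigraph → Set
Orientation G = Fin (m G) → Bool

incident : (G : Multigraph) → Fin (m G) → Fin (n G) → Bool
incident G e v = (proj₁ (ends G e) == v) ∨ (proj₂ (ends G e) == v)

head : (G : Multigraph) → Orientation G → Fin (m G) → Fin (n G)
head G D e = if D e then proj₂ (ends G e) else proj₁ (ends G e)

degA : (G : Multigraph) → IncPref G → Fin (n G) → ℕ
degA G A v = count (λ e → incident G e v ∧ lookup (A v) e)

indegA : (G : Multigraph) → IncPref G → Orientation G → Fin (n G) → ℕ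
indegA G A D v = count (λ e → (head G D e == v) ∧ lookup (A v) e)

-- |A(H)| for the induced subgraph H = G[W]: edges with both ends in W
-- that lie in A(u) ∩ A(v) for their endpoints u, v.
goodEdges : (G : Multigraph) → IncPref G → Subset (n G) → ℕ
goodEdges G A W = count (λ e →
  lookup W (proj₁ (ends G e)) ∧ lookup W (proj₂ (ends G e)) ∧
  lookup (A (proj₁ (ends G e))) e ∧ lookup (A (proj₂ (ends G e))) e)

∑in : ∀ {k} → Subset k → (Fin k → ℕ) → ℕ
∑in W f = ∑ (λ v → if lookup W v then f v else 0)

module Submission where

open import Defs
open import Data.Nat using (ℕ; zero; suc; _≤_; _<_; _+_; z≤n; _≤?_; _<?_)
import Data.Nat as ℕ
open import Data.Nat.Properties
  using (≤-refl; ≤-reflexive; <-irrefl; <-≤-trans; ≮⇒≥; +-identityʳ; +-comm; +-suc;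
         +-mono-≤; +-monoˡ-≤; +-monoˡ-<; +-monoʳ-<; +-cancelʳ-≤; +-0-commutativeMonoid;
         module ≤-Reasoning)
open import Data.Nat.Base using (s≤s⁻¹)
open import Data.Bool using (Bool; true; false; T; _∧_; _∨_; not; if_then_else_)
open import Data.Bool.Properties using (T-∧; ∨-identityʳ; ¬-not)
import Data.Bool.Properties as 𝔹
open import Data.Fin using (Fin; zero; suc)
import Data.Fin.Properties as Fin
open import Data.Fin.Subset using (Subset; _∈_; _⊆_; _∪_; _∩_; ⁅_⁆) renaming (⊥ to ∅)
open import Data.Fin.Subset.Properties
  using (_⊆?_; anySubset?; ⊆-trans; p∩q⊆p; x∈p∪q⁻; x∈⁅y⁆⇒x≡y)
open import Data.Vec using (lookup)
open import Data.Vec.Properties using (lookup-zipWith; lookup⇒[]=)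
open import Data.Product using (∃; ∃₂; _×_; _,_; proj₁; proj₂)
open import Data.Sum using (_⊎_; inj₁; inj₂; [_,_]′)
open import Data.Empty using (⊥; ⊥-elim)
open import Function using (_∘_)
open import Function.Bundles using (_⇔_; mk⇔; Equivalence)
open import Relation.Nullary using (Dec; yes; no)
open import Relation.Nullary.Decidable using (⌊_⌋; toWitness; _→-dec_; _×-dec_)
open import Relation.Binary.PropositionalEquality
  using (_≡_; refl; sym; trans; cong; cong₂; subst; module ≡-Reasoning)
open import Algebra.Properties.CommutativeMonoid.Sum +-0-commutativeMonoid
  using (sum; sum-cong-≗; ∑-distrib-+; ∑-comm)

-- Think of every edge f as a token that is handed to one of its two ends;
-- handing f to an end v is useful only if f ∈ A(v).  The supply of a vertex
-- set W is the number of edges that can usefully be handed to an end in W.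
-- Double counting gives  ∑_{v∈W} d(v,A) = supply(W) + |A(G[W])|,  so the
-- condition of the theorem is Hall's condition  g(W) ≤ supply(W)  for all
-- W ⊆ S.  Necessity: summed over W, the A-in-degrees of an orientation count
-- edges handed usefully into W.  Sufficiency follows the classical proof of
-- Hall's theorem: every edge keeps a set of candidate ends, initially the
-- ends preferring it.  While some edge has two candidates, one of them can be
-- dropped preserving Hall's condition, since demand is modular while supply
-- is submodular with one unit of slack at that edge.  When no edge has two
-- candidates, orienting each edge towards its candidate meets all demands.

⟦_⟧ : Bool → ℕ
⟦ b ⟧ = if b then 1 else 0

Family : ℕ → Set₁
Family zero    = Set
Family (suc k) = Bool → Family k

Valid : ∀ k → Family k → Set
Valid zero    P = P
Valid (suc k) P = ∀ b → Valid k (P b)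

Decisions : ∀ k → Family k → Set
Decisions zero    P = Dec P
Decisions (suc k) P = ∀ b → Decisions k (P b)

allYes : ∀ k {P : Family k} → Decisions k P → Bool
allYes zero    d = ⌊ d ⌋
allYes (suc k) d = allYes k (d true) ∧ allYes k (d false)

byTruthTable : ∀ k {P : Family k} (d : Decisions k P) {_ : T (allYes k d)} → Valid k P
byTruthTable zero    d {ok} = toWitness ok
byTruthTable (suc k) d {ok} true  = byTruthTable k (d true)  {proj₁ (Equivalence.to T-∧ ok)}
byTruthTable (suc k) d {ok} false = byTruthTable k (d false) {proj₂ (Equivalence.to T-∧ ok)}

-- An edge whose ends have memberships
-- p, q in a vertex set, and which may be handed to its first end when B₁
-- and to its second end when B₂, can be handed into the set iff it covers it.

covers : Bool → Bool → Bool → Bool → Bool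
covers B₁ p B₂ q = (B₁ ∧ p) ∨ (B₂ ∧ q)

covers-first : ∀ B₁ p B₂ q → ⟦ B₁ ∧ p ⟧ ≤ ⟦ covers B₁ p B₂ q ⟧
covers-first = byTruthTable 4 λ _ _ _ _ → _ ≤? _

covers-second : ∀ B₁ p B₂ q → ⟦ B₂ ∧ q ⟧ ≤ ⟦ covers B₁ p B₂ q ⟧
covers-second = byTruthTable 4 λ _ _ _ _ → _ ≤? _

-- Submodularity of supply at one edge, where t says that the edge is the
-- one (with both candidates present) losing its first candidate for X and
-- its second candidate for Y: covering X ∪ Y and X ∩ Y counts at most as
-- much as covering X and Y so reduced, plus one for that edge itself.
exchange : ∀ B₁ B₂ t xX xY yX yY → not t ∨ (B₁ ∧ B₂) ≡ true →
  ⟦ covers B₁ (xX ∨ xY) B₂ (yX ∨ yY) ⟧ + ⟦ covers B₁ (xX ∧ xY) B₂ (yX ∧ yY) ⟧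
  ≤ ⟦ covers (not t ∧ B₁) xX B₂ yX ⟧ + ⟦ covers B₁ xY (not t ∧ B₂) yY ⟧ + ⟦ t ⟧
exchange = byTruthTable 7 λ _ _ _ _ _ _ _ → (_ 𝔹.≟ _) →-dec (_ ≤? _)

-- An edge preferred by both of its ends inside W is counted twice by the
-- degrees: once for covering W and once as an A-good edge of G[W].
edge-degree : ∀ B₁ p B₂ q → ⟦ B₁ ∧ p ⟧ + ⟦ B₂ ∧ q ⟧ ≡ ⟦ covers B₁ p B₂ q ⟧ + ⟦ p ∧ q ∧ B₁ ∧ B₂ ⟧
edge-degree = byTruthTable 4 λ _ _ _ _ → _ ℕ.≟ _

-- An edge meeting v through at most one end (no loops) contributes to the
-- degree of v through that end only.
split-disjoint : ∀ s t p → s ∧ t ≡ false → ⟦ (s ∨ t) ∧ p ⟧ ≡ ⟦ s ∧ p ⟧ + ⟦ t ∧ p ⟧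
split-disjoint = byTruthTable 3 λ _ _ _ → (_ 𝔹.≟ _) →-dec (_ ℕ.≟ _)

-- Brings an equality test to the front, the shape used by count-at below.
∧-rotate : ∀ w t p → w ∧ (t ∧ p) ≡ t ∧ (p ∧ w)
∧-rotate = byTruthTable 3 λ _ _ _ → _ 𝔹.≟ _

credit-covers : ∀ B₁ B₂ p q px py → B₁ ∧ B₂ ≡ false →
  (B₁ ≡ true → px ≡ true) → (B₂ ≡ true → py ≡ true) →
  ⟦ covers B₁ p B₂ q ⟧ ≤ ⟦ if B₂ then py ∧ q else px ∧ p ⟧
credit-covers true  true  _ _ _ _ ()
credit-covers true  false p _ _ _ _ sound₁ _ rewrite sound₁ refl = ≤-reflexive (cong ⟦_⟧ (∨-identityʳ p))
credit-covers false true  _ _ _ _ _ _ sound₂ rewrite sound₂ refl = ≤-refl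
credit-covers false false _ _ _ _ _ _ _ = z≤n

both-true : ∀ {a b} → a ∧ b ≡ true → a ≡ true × b ≡ true
both-true {true} {true} refl = refl , refl

if-modular : ∀ a b (k : ℕ) →
  (if a ∨ b then k else 0) + (if a ∧ b then k else 0) ≡ (if a then k else 0) + (if b then k else 0)
if-modular true  true  k = refl
if-modular true  false k = refl
if-modular false true  k = +-comm k 0
if-modular false false k = refl

==-sound : ∀ {k} {a b : Fin k} → a == b ≡ true → a ≡ b
==-sound {a = a} {b} eq = toWitness {a? = a Fin.≟ b} (Equivalence.from 𝔹.T-≡ eq)

==-suc : ∀ {k} (c v : Fin k) → (suc c == suc v) ≡ (c == v)
==-suc c v with c Fin.≟ v
... | yes _ = refl
... | no  _ = refl

∑≡sum : ∀ {k} (f : Fin k → ℕ) → ∑ f ≡ sum f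
∑≡sum {zero}  f = refl
∑≡sum {suc k} f = cong (f zero +_) (∑≡sum (f ∘ suc))

∑-cong : ∀ {k} {f h : Fin k → ℕ} → (∀ i → f i ≡ h i) → ∑ f ≡ ∑ h
∑-cong {f = f} {h} eq = trans (∑≡sum f) (trans (sum-cong-≗ eq) (sym (∑≡sum h)))

∑-+ : ∀ {k} (f h : Fin k → ℕ) → ∑ (λ i → f i + h i) ≡ ∑ f + ∑ h
∑-+ f h = trans (∑≡sum (λ i → f i + h i)) (trans (∑-distrib-+ f h) (sym (cong₂ _+_ (∑≡sum f) (∑≡sum h))))

∑-swap : ∀ {k l} (F : Fin k → Fin l → ℕ) → ∑ (λ i → ∑ (F i)) ≡ ∑ (λ j → ∑ (λ i → F i j))
∑-swap F = begin
  ∑ (λ i → ∑ (F i))              ≡⟨ ∑-cong (λ i → ∑≡sum (F i)) ⟩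
  ∑ (λ i → sum (F i))            ≡⟨ ∑≡sum (λ i → sum (F i)) ⟩
  sum (λ i → sum (F i))          ≡⟨ ∑-comm F ⟩
  sum (λ j → sum (λ i → F i j))  ≡⟨ ∑≡sum (λ j → sum (λ i → F i j)) ⟨
  ∑ (λ j → sum (λ i → F i j))    ≡⟨ ∑-cong (λ j → ∑≡sum (λ i → F i j)) ⟨
  ∑ (λ j → ∑ (λ i → F i j))      ∎
  where open ≡-Reasoning

∑-mono : ∀ {k} {f h : Fin k → ℕ} → (∀ i → f i ≤ h i) → ∑ f ≤ ∑ h
∑-mono {zero}  le = z≤n
∑-mono {suc k} le = +-mono-≤ (le zero) (∑-mono (le ∘ suc))

count-none : ∀ {k} → count {k} (λ _ → false) ≡ 0
count-none {zero}  = refl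
count-none {suc k} = count-none {k}

count-at : ∀ {k} (c : Fin k) (P : Fin k → Bool) → count (λ v → (c == v) ∧ P v) ≡ ⟦ P c ⟧
count-at {suc k} zero P = trans (cong (⟦ P zero ⟧ +_) (count-none {k})) (+-identityʳ _)
count-at {suc k} (suc c) P =
  trans (∑-cong (λ v → cong (λ t → ⟦ t ∧ P (suc v) ⟧) (==-suc c v))) (count-at c (P ∘ suc))

count-single : ∀ {k} (c : Fin k) → count (c ==_) ≡ 1
count-single c = trans (∑-cong (λ v → cong ⟦_⟧ (sym (𝔹.∧-identityʳ (c == v))))) (count-at c _)

remove : ∀ {k} → Fin k → (Fin k → Bool) → Fin k → Bool
remove e b f = not (e == f) ∧ b f

count-remove : ∀ {k} {b : Fin k → Bool} (e : Fin k) → b e ≡ true → suc (count (remove e b)) ≡ count b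
count-remove zero    h rewrite h = refl
count-remove {b = b} (suc e) h = begin
  suc (⟦ b zero ⟧ + count (λ i → not (suc e == suc i) ∧ b (suc i)))
    ≡⟨ cong (λ r → suc (⟦ b zero ⟧ + r)) (∑-cong (λ i → cong (λ t → ⟦ not t ∧ b (suc i) ⟧) (==-suc e i))) ⟩
  suc (⟦ b zero ⟧ + count (remove e (b ∘ suc)))  ≡⟨ +-suc _ _ ⟨
  ⟦ b zero ⟧ + suc (count (remove e (b ∘ suc)))  ≡⟨ cong (⟦ b zero ⟧ +_) (count-remove e h) ⟩
  count b                                        ∎
  where open ≡-Reasoning

restrict : ∀ {k} → Subset k → (Fin k → ℕ) → Fin k → ℕ
restrict W h v = if lookup W v then h v else 0

∑in-cong : ∀ {k} (W : Subset k) {f h : Fin k → ℕ} → (∀ v → f v ≡ h v) → ∑in W f ≡ ∑in W h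
∑in-cong W eq = ∑-cong (λ v → cong (λ r → if lookup W v then r else 0) (eq v))

∑in-mono : ∀ {k} (W : Subset k) {f h : Fin k → ℕ} → (∀ v → v ∈ W → f v ≤ h v) → ∑in W f ≤ ∑in W h
∑in-mono W {f} {h} le = ∑-mono pointwise
  where
  pointwise : ∀ v → restrict W f v ≤ restrict W h v
  pointwise v with lookup W v in eq
  ... | true  = le v (lookup⇒[]= v W eq)
  ... | false = z≤n

∑in-+ : ∀ {k} (W : Subset k) (f h : Fin k → ℕ) → ∑in W (λ v → f v + h v) ≡ ∑in W f + ∑in W h
∑in-+ W f h = trans (∑-cong pointwise) (∑-+ (restrict W f) (restrict W h))
  where
  pointwise : ∀ v → restrict W (λ u → f u + h u) v ≡ restrict W f v + restrict W h v
  pointwise v with lookup W v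
  ... | true  = refl
  ... | false = refl

∑in-count : ∀ {k l} (W : Subset k) (P : Fin k → Fin l → Bool) →
  ∑in W (λ v → count (P v)) ≡ ∑ (λ v → count (λ f → lookup W v ∧ P v f))
∑in-count {l = l} W P = ∑-cong pointwise
  where
  pointwise : ∀ v → restrict W (count ∘ P) v ≡ count (λ f → lookup W v ∧ P v f)
  pointwise v with lookup W v
  ... | true  = refl
  ... | false = sym (count-none {l})

∑in-∅ : ∀ {k} (h : Fin k → ℕ) → ∑in ∅ h ≡ 0
∑in-∅ {zero}  h = refl
∑in-∅ {suc k} h = ∑in-∅ (h ∘ suc)

∑in-⁅⁆ : ∀ {k} (v : Fin k) (h : Fin k → ℕ) → ∑in ⁅ v ⁆ h ≡ h v
∑in-⁅⁆ zero    h = trans (cong (h zero +_) (∑in-∅ (h ∘ suc))) (+-identityʳ _)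
∑in-⁅⁆ (suc v) h = ∑in-⁅⁆ v (h ∘ suc)

∑in-modular : ∀ {k} (X Y : Subset k) (h : Fin k → ℕ) →
  ∑in (X ∪ Y) h + ∑in (X ∩ Y) h ≡ ∑in X h + ∑in Y h
∑in-modular X Y h =
  trans (sym (∑-+ (restrict (X ∪ Y) h) (restrict (X ∩ Y) h)))
        (trans (∑-cong pointwise) (∑-+ (restrict X h) (restrict Y h)))
  where
  pointwise : ∀ v → restrict (X ∪ Y) h v + restrict (X ∩ Y) h v ≡ restrict X h v + restrict Y h v
  pointwise v rewrite lookup-zipWith _∨_ v X Y | lookup-zipWith _∧_ v X Y =
    if-modular (lookup X v) (lookup Y v) (h v)

deficits : ∀ {a b c d} → a < c → b < d → suc (a + b) < c + d
deficits {a} {b} {c} {d} a<c b<d = subst (_≤ c + d) (cong suc (+-suc a b)) (+-mono-≤ a<c b<d)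

-- Edges f with ends x f and y f, where handing f to the end v is useful iff
-- perm v f.  An orientation D hands f to y f if D f and to x f otherwise.
module EdgeAssignment {n m : ℕ} (x y : Fin m → Fin n) (perm : Fin n → Fin m → Bool) where

  target : (Fin m → Bool) → Fin m → Fin n
  target D f = if D f then y f else x f

  indeg : (Fin m → Bool) → Fin n → ℕ
  indeg D v = count (λ f → (target D f == v) ∧ perm v f)

  inflow : (Fin m → Bool) → Subset n → ℕ
  inflow D W = count (λ f → perm (target D f) f ∧ lookup W (target D f))

  inflow-split : ∀ D W → ∑in W (indeg D) ≡ inflow D W
  inflow-split D W = begin
    ∑in W (indeg D)
      ≡⟨ ∑in-count W (λ v f → (target D f == v) ∧ perm v f) ⟩
    ∑ (λ v → count (λ f → lookup W v ∧ ((target D f == v) ∧ perm v f)))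
      ≡⟨ ∑-swap (λ v f → ⟦ lookup W v ∧ ((target D f == v) ∧ perm v f) ⟧) ⟩
    ∑ (λ f → count (λ v → lookup W v ∧ ((target D f == v) ∧ perm v f)))
      ≡⟨ ∑-cong (λ f → trans (∑-cong (λ v → cong ⟦_⟧ (∧-rotate (lookup W v) (target D f == v) (perm v f))))
                             (count-at (target D f) (λ v → perm v f ∧ lookup W v))) ⟩
    inflow D W
      ∎
    where open ≡-Reasoning

  pref₁ pref₂ : Fin m → Bool
  pref₁ f = perm (x f) f
  pref₂ f = perm (y f) f

  reach : (b₁ b₂ : Fin m → Bool) → Subset n → Fin m → Bool
  reach b₁ b₂ W f = covers (b₁ f) (lookup W (x f)) (b₂ f) (lookup W (y f))

  supply : (b₁ b₂ : Fin m → Bool) → Subset n → ℕ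
  supply b₁ b₂ W = count (reach b₁ b₂ W)

  inflow≤supply : ∀ D W → inflow D W ≤ supply pref₁ pref₂ W
  inflow≤supply D W = ∑-mono credit
    where
    credit : ∀ f → ⟦ perm (target D f) f ∧ lookup W (target D f) ⟧ ≤ ⟦ reach pref₁ pref₂ W f ⟧
    credit f with D f
    ... | true  = covers-second (pref₁ f) (lookup W (x f)) (pref₂ f) (lookup W (y f))
    ... | false = covers-first (pref₁ f) (lookup W (x f)) (pref₂ f) (lookup W (y f))

  supply≤inflow : ∀ b₁ b₂ W → (∀ f → b₁ f ∧ b₂ f ≡ false) →
    (∀ f → b₁ f ≡ true → perm (x f) f ≡ true) → (∀ f → b₂ f ≡ true → perm (y f) f ≡ true) →
    supply b₁ b₂ W ≤ inflow b₂ W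
  supply≤inflow b₁ b₂ W disjoint sound₁ sound₂ = ∑-mono credit
    where
    credit : ∀ f → ⟦ reach b₁ b₂ W f ⟧ ≤ ⟦ perm (target b₂ f) f ∧ lookup W (target b₂ f) ⟧
    credit f with b₂ f | disjoint f | sound₂ f
    ... | true  | disjoint-f | sound₂-f =
      credit-covers (b₁ f) true (lookup W (x f)) (lookup W (y f)) _ _ disjoint-f (sound₁ f) sound₂-f
    ... | false | disjoint-f | sound₂-f =
      credit-covers (b₁ f) false (lookup W (x f)) (lookup W (y f)) _ _ disjoint-f (sound₁ f) sound₂-f

  supply-exchange : ∀ b₁ b₂ e → b₁ e ≡ true → b₂ e ≡ true → ∀ X Y →
    supply b₁ b₂ (X ∪ Y) + supply b₁ b₂ (X ∩ Y)
      ≤ suc (supply (remove e b₁) b₂ X + supply b₁ (remove e b₂) Y)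
  supply-exchange b₁ b₂ e e₁ e₂ X Y = begin
    supply b₁ b₂ (X ∪ Y) + supply b₁ b₂ (X ∩ Y)
      ≡⟨ ∑-+ {m} _ _ ⟨
    ∑ (λ f → ⟦ reach b₁ b₂ (X ∪ Y) f ⟧ + ⟦ reach b₁ b₂ (X ∩ Y) f ⟧)
      ≤⟨ ∑-mono per-edge ⟩
    ∑ (λ f → ⟦ reach (remove e b₁) b₂ X f ⟧ + ⟦ reach b₁ (remove e b₂) Y f ⟧ + ⟦ e == f ⟧)
      ≡⟨ ∑-+ {m} _ _ ⟩
    ∑ (λ f → ⟦ reach (remove e b₁) b₂ X f ⟧ + ⟦ reach b₁ (remove e b₂) Y f ⟧) + count (e ==_)
      ≡⟨ cong₂ _+_ (∑-+ {m} _ _) (count-single e) ⟩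
    supply (remove e b₁) b₂ X + supply b₁ (remove e b₂) Y + 1
      ≡⟨ +-comm _ 1 ⟩
    suc (supply (remove e b₁) b₂ X + supply b₁ (remove e b₂) Y)
      ∎
    where
    open ≤-Reasoning
    candidates-at-e : ∀ f → not (e == f) ∨ (b₁ f ∧ b₂ f) ≡ true
    candidates-at-e f with e Fin.≟ f
    ... | yes refl = cong₂ _∧_ e₁ e₂
    ... | no  _    = refl
    per-edge : ∀ f → ⟦ reach b₁ b₂ (X ∪ Y) f ⟧ + ⟦ reach b₁ b₂ (X ∩ Y) f ⟧
                     ≤ ⟦ reach (remove e b₁) b₂ X f ⟧ + ⟦ reach b₁ (remove e b₂) Y f ⟧ + ⟦ e == f ⟧
    per-edge f
      rewrite lookup-zipWith _∨_ (x f) X Y | lookup-zipWith _∨_ (y f) X Y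
            | lookup-zipWith _∧_ (x f) X Y | lookup-zipWith _∧_ (y f) X Y =
      exchange (b₁ f) (b₂ f) (e == f) _ _ _ _ (candidates-at-e f)

  module Demand (S : Subset n) (g : Fin n → ℕ) where

    demand : Subset n → ℕ
    demand W = ∑in W g

    Hall : (b₁ b₂ : Fin m → Bool) → Set
    Hall b₁ b₂ = ∀ W → W ⊆ S → demand W ≤ supply b₁ b₂ W

    Deficient : (b₁ b₂ : Fin m → Bool) → Set
    Deficient b₁ b₂ = ∃ λ W → W ⊆ S × supply b₁ b₂ W < demand W

    hall-or-deficient : ∀ b₁ b₂ → Hall b₁ b₂ ⊎ Deficient b₁ b₂
    hall-or-deficient b₁ b₂ with anySubset? (λ W → (W ⊆? S) ×-dec (supply b₁ b₂ W <? demand W))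
    ... | yes deficient = inj₂ deficient
    ... | no  none      = inj₁ λ W W⊆S → ≮⇒≥ λ short → none (W , W⊆S , short)

    orientation⇒hall : ∀ D → (∀ v → v ∈ S → g v ≤ indeg D v) → Hall pref₁ pref₂
    orientation⇒hall D meets W W⊆S = begin
      demand W                ≤⟨ ∑in-mono W (λ v v∈W → meets v (W⊆S v∈W)) ⟩
      ∑in W (indeg D)         ≡⟨ inflow-split D W ⟩
      inflow D W              ≤⟨ inflow≤supply D W ⟩
      supply pref₁ pref₂ W    ∎
      where open ≤-Reasoning

    -- The two ways of dropping a candidate of e cannot both create a
    -- deficient set X resp. Y: modularity of demand on X ∪ Y and X ∩ Y
    -- against supply-exchange yields  g(X) + g(Y) < g(X) + g(Y).
    not-both-deficient : ∀ b₁ b₂ e → b₁ e ≡ true → b₂ e ≡ true → Hall b₁ b₂ →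
      Deficient (remove e b₁) b₂ → Deficient b₁ (remove e b₂) → ⊥
    not-both-deficient b₁ b₂ e e₁ e₂ hall (X , X⊆S , shortX) (Y , Y⊆S , shortY) =
      <-irrefl refl (begin-strict
        demand X + demand Y                           ≡⟨ ∑in-modular X Y g ⟨
        demand (X ∪ Y) + demand (X ∩ Y)               ≤⟨ +-mono-≤ (hall _ X∪Y⊆S) (hall _ X∩Y⊆S) ⟩
        supply b₁ b₂ (X ∪ Y) + supply b₁ b₂ (X ∩ Y)   ≤⟨ supply-exchange b₁ b₂ e e₁ e₂ X Y ⟩
        suc (supply (remove e b₁) b₂ X + supply b₁ (remove e b₂) Y)
                                                      <⟨ deficits shortX shortY ⟩
        demand X + demand Y                           ∎)
      where
      open ≤-Reasoning
      X∪Y⊆S : X ∪ Y ⊆ S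
      X∪Y⊆S v∈ = [ X⊆S , Y⊆S ]′ (x∈p∪q⁻ X Y v∈)
      X∩Y⊆S : X ∩ Y ⊆ S
      X∩Y⊆S = ⊆-trans (p∩q⊆p X Y) X⊆S

    exchange-step : ∀ b₁ b₂ e → b₁ e ≡ true → b₂ e ≡ true → Hall b₁ b₂ →
      Hall (remove e b₁) b₂ ⊎ Hall b₁ (remove e b₂)
    exchange-step b₁ b₂ e e₁ e₂ hall
      with hall-or-deficient (remove e b₁) b₂ | hall-or-deficient b₁ (remove e b₂)
    ... | inj₁ hall₁ | _          = inj₁ hall₁
    ... | inj₂ _     | inj₁ hall₂ = inj₂ hall₂
    ... | inj₂ defX  | inj₂ defY  = ⊥-elim (not-both-deficient b₁ b₂ e e₁ e₂ hall defX defY)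

    record Admissible (b₁ b₂ : Fin m → Bool) : Set where
      field
        hall   : Hall b₁ b₂
        sound₁ : ∀ f → b₁ f ≡ true → perm (x f) f ≡ true
        sound₂ : ∀ f → b₂ f ≡ true → perm (y f) f ≡ true
    open Admissible

    -- The total number of candidate ends, which every reduction step lowers.
    candidates : (b₁ b₂ : Fin m → Bool) → ℕ
    candidates b₁ b₂ = count b₁ + count b₂

    drop-candidate : ∀ b₁ b₂ e → b₁ e ∧ b₂ e ≡ true → Admissible b₁ b₂ →
      ∃₂ λ c₁ c₂ → Admissible c₁ c₂ × candidates c₁ c₂ < candidates b₁ b₂
    drop-candidate b₁ b₂ e both adm
      with both-true both
    ... | e₁ , e₂ with exchange-step b₁ b₂ e e₁ e₂ (hall adm)
    ...   | inj₁ hall₁ =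
      remove e b₁ , b₂ ,
      record { hall = hall₁ ; sound₁ = λ f h → sound₁ adm f (proj₂ (both-true h)) ; sound₂ = sound₂ adm } ,
      +-monoˡ-< (count b₂) (≤-reflexive (count-remove e e₁))
    ...   | inj₂ hall₂ =
      b₁ , remove e b₂ ,
      record { hall = hall₂ ; sound₁ = sound₁ adm ; sound₂ = λ f h → sound₂ adm f (proj₂ (both-true h)) } ,
      +-monoʳ-< (count b₁) (≤-reflexive (count-remove e e₂))

    -- Repeat until no edge has two candidates (k bounds the number of steps).
    resolve : ∀ k b₁ b₂ → candidates b₁ b₂ < k → Admissible b₁ b₂ →
      ∃₂ λ c₁ c₂ → Admissible c₁ c₂ × (∀ f → c₁ f ∧ c₂ f ≡ false)
    resolve zero    b₁ b₂ ()    adm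
    resolve (suc k) b₁ b₂ bound adm with Fin.any? (λ e → b₁ e ∧ b₂ e 𝔹.≟ true)
    ... | no  none       = b₁ , b₂ , adm , λ f → ¬-not λ both → none (f , both)
    ... | yes (e , both) with drop-candidate b₁ b₂ e both adm
    ...   | c₁ , c₂ , adm′ , fewer = resolve k c₁ c₂ (<-≤-trans fewer (s≤s⁻¹ bound)) adm′

    -- Reduce the preferring ends to single candidates; the orientation towards
    -- them then meets every demand, tested on singletons {v}.
    hall⇒orientation : Hall pref₁ pref₂ → ∃ λ D → ∀ v → v ∈ S → g v ≤ indeg D v
    hall⇒orientation H
      with resolve _ pref₁ pref₂ ≤-refl
             (record { hall = H ; sound₁ = λ _ p → p ; sound₂ = λ _ p → p })
    ... | b₁ , b₂ , adm , disjoint = b₂ , meets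
      where
      meets : ∀ v → v ∈ S → g v ≤ indeg b₂ v
      meets v v∈S = begin
        g v                    ≡⟨ ∑in-⁅⁆ v g ⟨
        demand ⁅ v ⁆           ≤⟨ hall adm ⁅ v ⁆ (λ u∈ → subst (_∈ S) (sym (x∈⁅y⁆⇒x≡y v u∈)) v∈S) ⟩
        supply b₁ b₂ ⁅ v ⁆     ≤⟨ supply≤inflow b₁ b₂ ⁅ v ⁆ disjoint (sound₁ adm) (sound₂ adm) ⟩
        inflow b₂ ⁅ v ⁆        ≡⟨ inflow-split b₂ ⁅ v ⁆ ⟨
        ∑in ⁅ v ⁆ (indeg b₂)   ≡⟨ ∑in-⁅⁆ v (indeg b₂) ⟩
        indeg b₂ v             ∎
        where open ≤-Reasoning

    orientation⇔hall : (∃ λ D → ∀ v → v ∈ S → g v ≤ indeg D v) ⇔ Hall pref₁ pref₂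
    orientation⇔hall = mk⇔ (λ (D , meets) → orientation⇒hall D meets) hall⇒orientation

module GraphAssignment (G : Multigraph) (A : IncPref G) where

  first second : Fin (m G) → Fin (n G)
  first e  = proj₁ (ends G e)
  second e = proj₂ (ends G e)

  open EdgeAssignment first second (λ v e → lookup (A v) e) public

  -- Since G has no loops, d(v,A) splits into the A-in-degrees of v under the
  -- two constant orientations.
  degree-split : ∀ v → degA G A v ≡ indeg (λ _ → false) v + indeg (λ _ → true) v
  degree-split v =
    trans (∑-cong (λ e → split-disjoint (first e == v) (second e == v) (lookup (A v) e) (not-both-ends e)))
          (∑-+ {m G} _ _)
    where
    not-both-ends : ∀ e → (first e == v) ∧ (second e == v) ≡ false
    not-both-ends e with first e == v in at₁ | second e == v in at₂
    ... | true  | true  = ⊥-elim (loopless G e (trans (==-sound at₁) (sym (==-sound at₂))))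
    ... | true  | false = refl
    ... | false | _     = refl

  degree-sum : ∀ W → ∑in W (degA G A) ≡ supply pref₁ pref₂ W + goodEdges G A W
  degree-sum W = begin
    ∑in W (degA G A)
      ≡⟨ ∑in-cong W degree-split ⟩
    ∑in W (λ v → indeg (λ _ → false) v + indeg (λ _ → true) v)
      ≡⟨ ∑in-+ W _ _ ⟩
    ∑in W (indeg (λ _ → false)) + ∑in W (indeg (λ _ → true))
      ≡⟨ cong₂ _+_ (inflow-split (λ _ → false) W) (inflow-split (λ _ → true) W) ⟩
    inflow (λ _ → false) W + inflow (λ _ → true) W
      ≡⟨ ∑-+ {m G} _ _ ⟨
    ∑ (λ e → ⟦ pref₁ e ∧ lookup W (first e) ⟧ + ⟦ pref₂ e ∧ lookup W (second e) ⟧)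
      ≡⟨ ∑-cong (λ e → edge-degree (pref₁ e) (lookup W (first e)) (pref₂ e) (lookup W (second e))) ⟩
    ∑ (λ e → ⟦ reach pref₁ pref₂ W e ⟧ + ⟦ lookup W (first e) ∧ lookup W (second e) ∧ pref₁ e ∧ pref₂ e ⟧)
      ≡⟨ ∑-+ {m G} _ _ ⟩
    supply pref₁ pref₂ W + goodEdges G A W
      ∎
    where open ≡-Reasoning

  hall⇔condition : ∀ (g : Fin (n G) → ℕ) W →
    ∑in W g ≤ supply pref₁ pref₂ W ⇔ ∑in W g + goodEdges G A W ≤ ∑in W (degA G A)
  hall⇔condition g W = mk⇔
    (λ hall → subst (∑in W g + goodEdges G A W ≤_) (sym (degree-sum W)) (+-monoˡ-≤ _ hall))
    (λ cond → +-cancelʳ-≤ _ _ _ (subst (∑in W g + goodEdges G A W ≤_) (degree-sum W) cond))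

lemma3p8 : (G : Multigraph) (A : IncPref G) (S : Subset (n G)) (g : Fin (n G) → ℕ) →
    (∃ λ (D : Orientation G) → ∀ v → v ∈ S → g v ≤ indegA G A D v)
    ⇔ (∀ (W : Subset (n G)) → W ⊆ S →
    ∑in W g + goodEdges G A W ≤ ∑in W (degA G A))
lemma3p8 G A S g = mk⇔
  (λ orientation W (W⊆S : W ⊆ S) → to (hall⇔condition g W) (to orientation⇔hall orientation W W⊆S))
  (λ condition → from orientation⇔hall (λ W (W⊆S : W ⊆ S) → from (hall⇔condition g W) (condition W W⊆S)))
  where
  open GraphAssignment G A
  open Demand S g
  open Equivalence
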